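{- Let $H$ be the graph with vertex set $\mathbb{Z}_4\times\mathbb{Z}_4$ in which distinct vertices $(a,b)$ and $(c,d)$ are adjacent if and only if $(a-c,\,b-d)$ (mod $4$) lies in $\{(0,1),(0,3),(1,0),(3,0),(1,1),(3,3)\}$. Then for every $\ell\ge 6$, $H$ has no induced subgraph isomorphic to $\overline{C_\ell}$, the complement of the cycle on $\ell$ vertices. -}

module Defs where

open import Data.Nat using (ℕ; suc; _+_; _∸_; _%_)
open import Data.Fin using (Fin; toℕ)
open import Data.Product using (_×_; _,_; Σ)
open import Function.Definitions using (Injective)
open import Data.Sum using (_⊎_)
open import Relation.Binary.PropositionalEquality using (_≡_)
open import Relation.Nullary using (¬_)
open import Function using (_⇔_)

diff4 : Fin 4 → Fin 4 → ℕ
diff4 a c = (toℕ a + 4 ∸ toℕ c) % 4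

V : Set
V = Fin 4 × Fin 4

InS : ℕ → ℕ → Set
InS x y = ((x ≡ 0) × (y ≡ 1)) ⊎ ((x ≡ 0) × (y ≡ 3)) ⊎ ((x ≡ 1) × (y ≡ 0))
        ⊎ ((x ≡ 3) × (y ≡ 0)) ⊎ ((x ≡ 1) × (y ≡ 1)) ⊎ ((x ≡ 3) × (y ≡ 3))

AdjH : V → V → Set
AdjH (a , b) (c , d) = ¬ ((a , b) ≡ (c , d)) × InS (diff4 a c) (diff4 b d)

-- Cycle C_ℓ on vertex set Fin ℓ (vertices 0,1,…,ℓ-1 in cyclic order):
-- i ~ j iff j = i+1, or i = ℓ-1 and j = 0 (i.e. j ≡ i+1 mod ℓ), or symmetrically
Succ : (ℓ : ℕ) → Fin ℓ → Fin ℓ → Set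
Succ ℓ i j = (toℕ j ≡ suc (toℕ i)) ⊎ ((suc (toℕ i) ≡ ℓ) × (toℕ j ≡ 0))

AdjC : (ℓ : ℕ) → Fin ℓ → Fin ℓ → Set
AdjC ℓ i j = Succ ℓ i j ⊎ Succ ℓ j i

AdjCbar : (ℓ : ℕ) → Fin ℓ → Fin ℓ → Set
AdjCbar ℓ i j = ¬ (i ≡ j) × ¬ AdjC ℓ i j

InducedCbar : (ℓ : ℕ) → Set
InducedCbar ℓ = Σ (Fin ℓ → V) λ f →
  Injective _≡_ _≡_ f × (∀ i j → AdjH (f i) (f j) ⇔ AdjCbar ℓ i j)

-- If f embeds C̄ℓ (ℓ ≥ 6) as an induced subgraph of H, the vertices f 0, …, f 5 are constrained
-- pairwise: consecutive ones are non-adjacent and every other pair except {f 0, f 5} is adjacent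
-- ({0, 5} is an edge of C̄ℓ exactly when ℓ > 6). A backtracking search over the 16 vertices of H
-- (the Shrikhande graph), choosing f 0, f 1, … in turn and pruning as soon as a constraint fails,
-- shows that no six vertices satisfy this.
module Submission where

open import Defs
open import Level using (0ℓ)
open import Data.Nat using (ℕ; zero; suc; _<_; _≤_; _≥_; s≤s)
open import Data.Nat.Properties using (_≟_; _<?_; <-asym; <-irrefl; <-trans; ≤-<-trans; ≤⇒≯; ≤-reflexive; n<1+n)
open import Data.Fin using (Fin; toℕ)
open import Data.Fin.Patterns using (0F; 1F; 2F; 3F; 4F; 5F)
open import Data.Fin.Properties using (any?; toℕ<n) renaming (_≟_ to _≟ᶠ_)
open import Data.List using (List; []; _∷_; length)
open import Data.Product using (_×_; _,_; ∃)
open import Data.Product.Properties using (≡-dec)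
open import Data.Sum using (inj₁; inj₂)
open import Data.Unit using (⊤; tt)
open import Function using (_⇔_)
open import Function.Bundles using (Equivalence)
open import Relation.Binary.PropositionalEquality using (_≡_; sym; cong; subst)
open import Relation.Nullary using (¬_; Dec; yes; ¬?; _×-dec_; _⊎-dec_; _→-dec_)
open import Relation.Nullary.Decidable using (map′; from-no)
open import Relation.Unary using (Pred; Decidable)

-- Sequences a₀, a₁, … in which each pair of positions m < k is subject to a constraint R k m aₖ aₘ.
-- A partial sequence is kept as a stack, its last element on top.
module PairwiseConstrainedSequences {A : Set} (R : ℕ → ℕ → A → A → Set) where

  FitsAt : ℕ → A → List A → Set
  FitsAt k a []       = ⊤
  FitsAt k a (b ∷ bs) = R k (length bs) a b × FitsAt k a bs

  Extension : ℕ → List A → Set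
  Extension zero    as = ⊤
  Extension (suc r) as = ∃ λ a → FitsAt (length as) a as × Extension r (a ∷ as)

  module Search (R? : ∀ k m a b → Dec (R k m a b))
                (∃? : ∀ {P : Pred A 0ℓ} → Decidable P → Dec (∃ P)) where

    fitsAt? : ∀ k a bs → Dec (FitsAt k a bs)
    fitsAt? k a []       = yes tt
    fitsAt? k a (b ∷ bs) = R? k (length bs) a b ×-dec fitsAt? k a bs

    extension? : ∀ r as → Dec (Extension r as)
    extension? zero    as = yes tt
    extension? (suc r) as = ∃? λ a → fitsAt? (length as) a as ×-dec extension? r (a ∷ as)

InS? : ∀ x y → Dec (InS x y)
InS? x y = (x ≟ 0 ×-dec y ≟ 1) ⊎-dec (x ≟ 0 ×-dec y ≟ 3) ⊎-dec (x ≟ 1 ×-dec y ≟ 0)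
         ⊎-dec (x ≟ 3 ×-dec y ≟ 0) ⊎-dec (x ≟ 1 ×-dec y ≟ 1) ⊎-dec (x ≟ 3 ×-dec y ≟ 3)

AdjH? : ∀ u v → Dec (AdjH u v)
AdjH? (a , b) (c , d) = ¬? (≡-dec _≟ᶠ_ _≟ᶠ_ (a , b) (c , d)) ×-dec InS? (diff4 a c) (diff4 b d)

anyV? : ∀ {P : Pred V 0ℓ} → Decidable P → Dec (∃ P)
anyV? P? = map′ (λ (a , b , p) → (a , b) , p) (λ ((a , b) , p) → a , b , p)
                (any? λ a → any? λ b → P? (a , b))

-- The pattern of the first six vertices of C̄ℓ, ℓ ≥ 6, at positions m < k.
CoCycleConstraint : ℕ → ℕ → V → V → Set
CoCycleConstraint k m u v = (k ≡ suc m → ¬ AdjH u v) × (suc m < k → (m ≡ 0 → k < 5) → AdjH u v)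

coCycleConstraint? : ∀ k m u v → Dec (CoCycleConstraint k m u v)
coCycleConstraint? k m u v = (k ≟ suc m →-dec ¬? (AdjH? u v))
                      ×-dec (suc m <? k →-dec (m ≟ 0 →-dec k <? 5) →-dec AdjH? u v)

open PairwiseConstrainedSequences CoCycleConstraint
open Search coCycleConstraint? anyV?

no-coCycle-prefix : ¬ Extension 6 []
no-coCycle-prefix = from-no (extension? 6 [])

¬AdjC-apart : ∀ {ℓ} (i j : Fin ℓ) → suc (toℕ j) < toℕ i →
              ¬ (suc (toℕ i) ≡ ℓ × toℕ j ≡ 0) → ¬ AdjC ℓ i j
¬AdjC-apart i j apart ¬wrap (inj₁ (inj₁ j≡1+i)) = <-asym (<-trans (n<1+n _) apart) (≤-reflexive (sym j≡1+i))
¬AdjC-apart i j apart ¬wrap (inj₁ (inj₂ wrap))  = ¬wrap wrap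
¬AdjC-apart i j apart ¬wrap (inj₂ (inj₁ i≡1+j)) = <-irrefl (sym i≡1+j) apart
¬AdjC-apart i j apart ¬wrap (inj₂ (inj₂ (1+j≡ℓ , _))) =
  <-irrefl 1+j≡ℓ (≤-<-trans (<-trans (n<1+n _) apart) (toℕ<n i))

initialSegment-coCycleConstraint : ∀ {ℓ} → ℓ ≥ 6 → (f : Fin ℓ → V) →
  (∀ i j → AdjH (f i) (f j) ⇔ AdjCbar ℓ i j) →
  ∀ i j → CoCycleConstraint (toℕ i) (toℕ j) (f i) (f j)
initialSegment-coCycleConstraint {ℓ} ℓ≥6 f f-induces i j = consecutive , apart
  where
  open Equivalence
  consecutive : toℕ i ≡ suc (toℕ j) → ¬ AdjH (f i) (f j)
  consecutive i≡1+j adj = let (_ , ¬cycleAdj) = to (f-induces i j) adj in ¬cycleAdj (inj₂ (inj₁ i≡1+j))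
  apart : suc (toℕ j) < toℕ i → (toℕ j ≡ 0 → toℕ i < 5) → AdjH (f i) (f j)
  apart j+1<i j≡0⇒i<5 = from (f-induces i j) (i≢j , ¬AdjC-apart i j j+1<i ¬wrap)
    where
    i≢j : ¬ i ≡ j
    i≢j i≡j = <-irrefl (cong toℕ (sym i≡j)) (<-trans (n<1+n _) j+1<i)
    ¬wrap : ¬ (suc (toℕ i) ≡ ℓ × toℕ j ≡ 0)
    ¬wrap (1+i≡ℓ , j≡0) = ≤⇒≯ (subst (_≤ 5) 1+i≡ℓ (j≡0⇒i<5 j≡0)) ℓ≥6

lemma2p3 : ∀ (ℓ : ℕ) → ℓ ≥ 6 → ¬ InducedCbar ℓ
lemma2p3 _ ℓ≥6@(s≤s (s≤s (s≤s (s≤s (s≤s (s≤s _)))))) (f , _ , f-induces) = no-coCycle-prefix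
  ( f 0F , tt
  , f 1F , (c 1F 0F , tt)
  , f 2F , (c 2F 1F , c 2F 0F , tt)
  , f 3F , (c 3F 2F , c 3F 1F , c 3F 0F , tt)
  , f 4F , (c 4F 3F , c 4F 2F , c 4F 1F , c 4F 0F , tt)
  , f 5F , (c 5F 4F , c 5F 3F , c 5F 2F , c 5F 1F , c 5F 0F , tt)
  , tt )
  where
  c : ∀ i j → CoCycleConstraint (toℕ i) (toℕ j) (f i) (f j)
  c = initialSegment-coCycleConstraint ℓ≥6 f f-induces
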